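{- Let $\mathbf N=(N_0,\dots,N_{n-1},-\sum_iN_i)$ with each $N_i\in\mathbb Z_{\ge0}$. A weak composition $\mathbf j=(j_0,\dots,j_{n-1})$ of $\binom n2$ lies in $\mathcal S^+_n(\mathbf N)$ if and only if $j_i\le N_i+n-i-1$ for $i=0,\dots,n-1$ and $\sum_{i=0}^k j_i\ge\sum_{i=0}^k(n-1-i)$ for all $k=0,\dots,n-1$.
   Context: $K_n(\mathbf V)$, for $\mathbf V=(V_0,\dots,V_n)\in\mathbb Z^{n+1}$ with $V_n=-\sum_{i<n}V_i$, is the number of integer vectors $(f_{ij})_{0\le i<j\le n}$ with $f_{ij}\ge0$ and $\sum_{j>i}f_{ij}-\sum_{k<i}f_{ki}=V_i$ for all $i$. Let $\boldsymbol\delta=(n-1,n-2,\dots,1,0)$; for a weak composition $\mathbf j$ of $\binom n2$ with $n$ parts, $K_n(\mathbf j-\boldsymbol\delta)$ means $K_n(j_0-(n-1),j_1-(n-2),\dots,j_{n-1}-0,0)$. $\mathcal S^+_n(\mathbf N)$ is the set of weak compositions $\mathbf j$ of $\binom n2$ with $n$ parts such that $\binom{N_0+n-1}{j_0}\binom{N_1+n-2}{j_1}\cdots\binom{N_{n-1}}{j_{n-1}}\cdot K_n(\mathbf j-\boldsymbol\delta)>0$. -}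

module Defs where

open import Data.Nat using (ℕ; zero; suc; _+_; _*_; _∸_; _<_)
open import Data.Nat.Combinatorics using (_C_)
open import Data.Integer as ℤ using (ℤ; +_; +0; -[1+_])
open import Data.Fin using (Fin; toℕ)
open import Data.Vec using (Vec; []; _∷_; _∷ʳ_; lookup; tabulate; zipWith; sum; foldr)
import Data.Nat.ListAction as LA
open import Data.List as List using (List; upTo; concatMap)
open import Relation.Binary.PropositionalEquality using (_≡_)
open import Data.Product using (_×_)
import Data.Vec

compositions : (k m : ℕ) → List (Vec ℕ k)
compositions zero zero = List.[ [] ]
compositions zero (suc m) = List.[]
compositions (suc k) m =
  concatMap (λ a → List.map (a ∷_) (compositions k (m ∸ a))) (upTo (suc m))

-- Kostant partition function K_n(V), V = (V_0,…,V_n) ∈ ℤ^{n+1}: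
-- the number of (f_ij)_{0≤i<j≤n}, f_ij ∈ ℕ, with
--   Σ_{j>i} f_ij − Σ_{k<i} f_ki = V_i   for all i = 0..n.
-- Computed by exact enumeration: the outgoing flows (f_01,…,f_0n) of vertex 0
-- range over the weak compositions of V_0 into n parts (none if V_0 < 0);
-- each choice reduces to the same count on vertices 1..n with V_j
-- replaced by V_j + f_0j.  At the single remaining vertex the only
-- (empty) flow works iff its value is 0.
K : (n : ℕ) → Vec ℤ (suc n) → ℕ
K zero (+ zero ∷ []) = 1
K zero (+ suc _ ∷ []) = 0
K zero (-[1+ _ ] ∷ []) = 0
K (suc n) (-[1+ _ ] ∷ V) = 0
K (suc n) (+ v₀ ∷ V) =
  LA.sum (List.map (λ c → K n (zipWith ℤ._+_ V (Data.Vec.map +_ c)))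
                     (compositions (suc n) v₀))

δ : (n : ℕ) → Vec ℕ n
δ n = tabulate (λ i → n ∸ suc (toℕ i))

j-δ : (n : ℕ) → Vec ℕ n → Vec ℤ (suc n)
j-δ n j = tabulate (λ i → + lookup j i ℤ.- + (n ∸ suc (toℕ i))) ∷ʳ + 0

IsWeakComp : (n : ℕ) → Vec ℕ n → Set
IsWeakComp n j = sum j ≡ n C 2

-- j ∈ S⁺_n(N):  Π_i C(N_i + n−1−i, j_i) · K_n(j − δ) > 0
-- (only N_0..N_{n−1} enter; the last entry −Σ N_i of 𝐍 plays no role)
InSplus : (n : ℕ) → Vec ℕ n → Vec ℕ n → Set
InSplus n N j =
  IsWeakComp n j ×
  0 < foldr _ _*_ 1 (tabulate (λ i → (lookup N i + (n ∸ suc (toℕ i))) C lookup j i)) * K n (j-δ n j)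

psum : {m : ℕ} → Vec ℕ m → ℕ → ℕ
psum [] _ = 0
psum (x ∷ xs) zero = x
psum (x ∷ xs) (suc k) = x + psum xs k

{-# OPTIONS --safe #-}
module Submission where

-- A product of binomial coefficients is positive iff every factor is, which is the
-- bound j_i ≤ N_i + n − 1 − i.  The Kostant partition function K_n(V) is positive
-- iff some nonnegative flow on the complete acyclic graph on 0..n has net outflow V,
-- i.e. iff every prefix sum V_0 + … + V_k is nonnegative and the total is 0: the
-- outflow of vertex 0 is spread over the later vertices, and for the converse it can
-- all be sent to vertex 1.  For V = j − δ the prefix sums are Σ_{i≤k} j_i − Σ_{i≤k} δ_i,
-- and the total vanishes because Σ δ = C(n,2) = Σ j.

open import Defs
open import Data.Nat using (ℕ; suc; _+_; _∸_; _≤_)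
open import Data.Fin using (Fin; toℕ)
open import Data.Vec using (Vec; lookup)
open import Data.Product using (_×_)
open import Function.Bundles using (_⇔_)

open import Data.Nat as ℕ using (zero; _*_; _<_; z≤n; s≤s; z<s; >-nonZero; >-nonZero⁻¹)
open import Data.Nat.Properties
  using (≤-trans; m≤m+n; m≤n+m; ≤-pred; ≮⇒≥; n>0⇒n≢0; m+n∸m≡n; m+[n∸m]≡n;
         +-identityʳ; +-comm; +-∸-assoc; ∸-+-assoc; m*n≢0; m*n≢0⇒m≢0; m*n≢0⇒n≢0)
open import Data.Nat.Combinatorics using (_C_; k>n⇒nCk≡0; nCk+nC[k+1]≡[n+1]C[k+1]; nC1≡n)
import Data.Nat.ListAction as ℕₗ
open import Data.Integer as ℤ using (ℤ; +_; +0; +≤+)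
import Data.Integer.Properties as ℤ
open import Data.Integer.Solver using (module +-*-Solver)
import Data.Fin as Fin
open import Data.Fin.Properties using (toℕ<n; ∀-cons-⇔)
open import Data.Vec using ([]; _∷_; tabulate; zipWith; sum; foldr; _∷ʳ_; replicate)
open import Data.List as List using (upTo)
open import Data.List.Relation.Unary.Any using (here; there)
open import Data.List.Membership.Propositional using (_∈_; find)
open import Data.List.Membership.Propositional.Properties
  using (∈-map⁺; ∈-map⁻; ∈-concat⁺′; ∈-concatMap⁻; ∈-upTo⁺; ∈-upTo⁻)
open import Data.Product using (∃-syntax; _,_; proj₂)
open import Data.Product.Function.NonDependent.Propositional using (_×-⇔_)
open import Function using (_∘_)
open import Function.Bundles using (mk⇔; Equivalence)
open import Function.Construct.Composition using (_⇔-∘_)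
open import Function.Construct.Identity using (⇔-id)
open import Relation.Binary.PropositionalEquality

Π-cong-⇔ : ∀ {a p q} {A : Set a} {P : A → Set p} {Q : A → Set q} →
           (∀ x → P x ⇔ Q x) → (∀ x → P x) ⇔ (∀ x → Q x)
Π-cong-⇔ P⇔Q = mk⇔ (λ h x → Equivalence.to (P⇔Q x) (h x))
                   (λ h x → Equivalence.from (P⇔Q x) (h x))

k≤n⇒0<nCk : ∀ {n k} → k ≤ n → 0 < n C k
k≤n⇒0<nCk {n} {zero} _ = z<s
k≤n⇒0<nCk {suc n} {suc k} (s≤s k≤n) =
  subst (0 <_) (nCk+nC[k+1]≡[n+1]C[k+1] n k) (≤-trans (k≤n⇒0<nCk k≤n) (m≤m+n _ _))

0<nCk⇔k≤n : ∀ n k → 0 < n C k ⇔ k ≤ n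
0<nCk⇔k≤n n k = mk⇔ (λ 0<nCk → ≮⇒≥ (n>0⇒n≢0 0<nCk ∘ k>n⇒nCk≡0)) k≤n⇒0<nCk

0<m*n⇔0<m×0<n : ∀ m n → 0 < m * n ⇔ (0 < m × 0 < n)
0<m*n⇔0<m×0<n m n = mk⇔
  (λ 0<m*n → >-nonZero⁻¹ m {{m*n≢0⇒m≢0 m {{>-nonZero 0<m*n}}}} ,
             >-nonZero⁻¹ n {{m*n≢0⇒n≢0 m {{>-nonZero 0<m*n}}}})
  (λ (0<m , 0<n) → >-nonZero⁻¹ (m * n) {{m*n≢0 m n {{>-nonZero 0<m}} {{>-nonZero 0<n}}}})

0<product⇔all-0< : ∀ m (f : Fin m → ℕ) →
                   0 < foldr _ _*_ 1 (tabulate f) ⇔ (∀ i → 0 < f i)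
0<product⇔all-0< zero f = mk⇔ (λ _ ()) (λ _ → z<s)
0<product⇔all-0< (suc m) f =
  ∀-cons-⇔ ⇔-∘ ((⇔-id _ ×-⇔ 0<product⇔all-0< m (f ∘ Fin.suc)) ⇔-∘ 0<m*n⇔0<m×0<n _ _)

∈⇒≤sum-map : ∀ {a} {A : Set a} (f : A → ℕ) {x xs} →
             x ∈ xs → f x ≤ ℕₗ.sum (List.map f xs)
∈⇒≤sum-map f (here refl) = m≤m+n _ _
∈⇒≤sum-map f {xs = y List.∷ _} (there x∈xs) =
  ≤-trans (∈⇒≤sum-map f x∈xs) (m≤n+m _ (f y))

0<sum-map⇒∃∈ : ∀ {a} {A : Set a} (f : A → ℕ) xs →
               0 < ℕₗ.sum (List.map f xs) → ∃[ x ] x ∈ xs × 0 < f x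
0<sum-map⇒∃∈ f (x List.∷ xs) 0<sum with f x in fx≡
... | zero  = let y , y∈xs , 0<fy = 0<sum-map⇒∃∈ f xs 0<sum in y , there y∈xs , 0<fy
... | suc _ = x , here refl , subst (0 <_) (sym fx≡) z<s

∈-compositions⁺ : ∀ {k m} (c : Vec ℕ k) → sum c ≡ m → c ∈ compositions k m
∈-compositions⁺ [] refl = here refl
∈-compositions⁺ {suc k} (a ∷ c) refl =
  ∈-concat⁺′ (∈-map⁺ (a ∷_) (∈-compositions⁺ c (sym (m+n∸m≡n a (sum c)))))
             (∈-map⁺ (λ b → List.map (b ∷_) (compositions k (a + sum c ∸ b)))
                     (∈-upTo⁺ (s≤s (m≤m+n a (sum c)))))

∈-compositions⁻ : ∀ k m {c} → c ∈ compositions k m → sum c ≡ m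
∈-compositions⁻ zero zero (here refl) = refl
∈-compositions⁻ (suc k) m c∈ with find (∈-concatMap⁻ _ {xs = upTo (suc m)} c∈)
... | a , a∈upTo , c∈a∷ with ∈-map⁻ (a ∷_) c∈a∷
...   | c′ , c′∈ , refl = begin
  a + sum c′   ≡⟨ cong (ℕ._+_ a) (∈-compositions⁻ k (m ∸ a) c′∈) ⟩
  a + (m ∸ a)  ≡⟨ m+[n∸m]≡n (≤-pred (∈-upTo⁻ a∈upTo)) ⟩
  m            ∎
  where open ≡-Reasoning

-- s is the prefix sum carried in: every proper prefix sum of s ∷ V must be
-- nonnegative and the full sum zero.
Feasible : ∀ {m} → ℤ → Vec ℤ (suc m) → Set
Feasible {zero}  s (v ∷ []) = s ℤ.+ v ≡ +0
Feasible {suc m} s (v ∷ V) = +0 ℤ.≤ s ℤ.+ v × Feasible (s ℤ.+ v) V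

feasible-head : ∀ {m s t v w} (V : Vec ℤ m) →
                s ℤ.+ v ≡ t ℤ.+ w → Feasible s (v ∷ V) → Feasible t (w ∷ V)
feasible-head []      eq f       = trans (sym eq) f
feasible-head (u ∷ V) eq (p , f) =
  subst (+0 ℤ.≤_) eq p , subst (λ s → Feasible s (u ∷ V)) eq f

infixl 6 _⊕_
_⊕_ : ∀ {m} → Vec ℤ m → Vec ℕ m → Vec ℤ m
V ⊕ c = zipWith ℤ._+_ V (Data.Vec.map +_ c)

⊕-replicate-0 : ∀ {m} (V : Vec ℤ m) → V ⊕ replicate m 0 ≡ V
⊕-replicate-0 []      = refl
⊕-replicate-0 (v ∷ V) = cong₂ _∷_ (ℤ.+-identityʳ v) (⊕-replicate-0 V)

sum-replicate-0 : ∀ n → sum (replicate n 0) ≡ 0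
sum-replicate-0 zero    = refl
sum-replicate-0 (suc n) = sum-replicate-0 n

[s+[v+x]]+y≡[s+[x+y]]+v : ∀ s v x y →
  (s ℤ.+ (v ℤ.+ + x)) ℤ.+ + y ≡ (s ℤ.+ + (x + y)) ℤ.+ v
[s+[v+x]]+y≡[s+[x+y]]+v s v x y rewrite ℤ.pos-+ x y =
  solve 4 (λ s v x y → (s :+ (v :+ x)) :+ y := (s :+ (x :+ y)) :+ v) refl s v (+ x) (+ y)
  where open +-*-Solver

feasible-⊕⁻ : ∀ {m} s (V : Vec ℤ (suc m)) (c : Vec ℕ (suc m)) →
              Feasible s (V ⊕ c) → Feasible (s ℤ.+ + sum c) V
feasible-⊕⁻ {zero} s (v ∷ []) (x ∷ []) f =
  trans (sym ([s+[v+x]]+y≡[s+[x+y]]+v s v x 0)) (cong (ℤ._+ +0) f)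
feasible-⊕⁻ {suc m} s (v ∷ V) (x ∷ c) (p , f) =
  subst (+0 ℤ.≤_) eq (ℤ.+-mono-≤ p (+≤+ z≤n)) ,
  subst (λ t → Feasible t V) eq (feasible-⊕⁻ _ V c f)
  where eq = [s+[v+x]]+y≡[s+[x+y]]+v s v x (sum c)

0<K⇒feasible : ∀ n (V : Vec ℤ (suc n)) → 0 < K n V → Feasible +0 V
0<K⇒feasible zero    (+ zero ∷ []) _ = refl
0<K⇒feasible (suc n) (+ a ∷ V) 0<K
  with c , c∈ , 0<K′ ← 0<sum-map⇒∃∈ (λ c → K n (V ⊕ c)) (compositions (suc n) a) 0<K =
  +≤+ z≤n ,
  subst (λ s → Feasible s V) (cong +_ (∈-compositions⁻ (suc n) a c∈))
        (feasible-⊕⁻ +0 V c (0<K⇒feasible n (V ⊕ c) 0<K′))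

-- Routing all the outflow of vertex 0 to vertex 1 gives a flow.
feasible⇒0<K : ∀ n (V : Vec ℤ (suc n)) → Feasible +0 V → 0 < K n V
feasible⇒0<K zero    (+ zero ∷ [])  _       = z<s
feasible⇒0<K (suc n) (+ a ∷ v ∷ V) (_ , f) =
  ≤-trans (feasible⇒0<K n (W ⊕ c) f′)
          (∈⇒≤sum-map (λ c → K n (W ⊕ c)) (∈-compositions⁺ c sum-c≡a))
  where
  W = v ∷ V
  c = a ∷ replicate n 0
  sum-c≡a : sum c ≡ a
  sum-c≡a = trans (cong (ℕ._+_ a) (sum-replicate-0 n)) (+-identityʳ a)
  f′ : Feasible +0 (W ⊕ c)
  f′ = subst (λ V′ → Feasible +0 ((v ℤ.+ + a) ∷ V′)) (sym (⊕-replicate-0 V))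
             (feasible-head V (trans (ℤ.+-comm (+ a) v) (sym (ℤ.+-identityˡ _))) f)

0<K⇔feasible : ∀ n (V : Vec ℤ (suc n)) → 0 < K n V ⇔ Feasible +0 V
0<K⇔feasible n V = mk⇔ (0<K⇒feasible n V) (feasible⇒0<K n V)

infixl 6 _⊖_
_⊖_ : ∀ {m} → Vec ℕ m → Vec ℕ m → Vec ℤ m
a ⊖ b = zipWith (λ x y → + x ℤ.- + y) a b

tabulate-lookup≡zipWith : ∀ {a b c} {A : Set a} {B : Set b} {C : Set c} {m}
  (f : A → B → C) (xs : Vec A m) (g : Fin m → B) →
  tabulate (λ i → f (lookup xs i) (g i)) ≡ zipWith f xs (tabulate g)
tabulate-lookup≡zipWith f []       g = refl
tabulate-lookup≡zipWith f (x ∷ xs) g =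
  cong (f x (g Fin.zero) ∷_) (tabulate-lookup≡zipWith f xs (g ∘ Fin.suc))

j-δ≡⊖∷ʳ0 : ∀ n (j : Vec ℕ n) → j-δ n j ≡ (j ⊖ δ n) ∷ʳ +0
j-δ≡⊖∷ʳ0 n j =
  cong (_∷ʳ +0) (tabulate-lookup≡zipWith (λ x y → + x ℤ.- + y) j (λ i → n ∸ suc (toℕ i)))

[s+[x-y]]+[p-q]≡s+[[x+p]-[y+q]] : ∀ s x y p q →
  (s ℤ.+ (+ x ℤ.- + y)) ℤ.+ (+ p ℤ.- + q) ≡ s ℤ.+ (+ (x + p) ℤ.- + (y + q))
[s+[x-y]]+[p-q]≡s+[[x+p]-[y+q]] s x y p q rewrite ℤ.pos-+ x p | ℤ.pos-+ y q =
  solve 5 (λ s x y p q → (s :+ (x :- y)) :+ (p :- q) := s :+ ((x :+ p) :- (y :+ q)))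
          refl s (+ x) (+ y) (+ p) (+ q)
  where open +-*-Solver

PrefixSumsNonneg : ∀ {m} → ℤ → Vec ℕ m → Vec ℕ m → Set
PrefixSumsNonneg {m} s a b =
  (k : Fin m) → +0 ℤ.≤ s ℤ.+ (+ psum a (toℕ k) ℤ.- + psum b (toℕ k))

feasible⇒prefixSumsNonneg : ∀ {m} s (a b : Vec ℕ m) →
                            Feasible s ((a ⊖ b) ∷ʳ +0) → PrefixSumsNonneg s a b
feasible⇒prefixSumsNonneg s (x ∷ a) (y ∷ b) (p , f) Fin.zero    = p
feasible⇒prefixSumsNonneg s (x ∷ a) (y ∷ b) (p , f) (Fin.suc k) =
  subst (+0 ℤ.≤_) ([s+[x-y]]+[p-q]≡s+[[x+p]-[y+q]] s x y _ _)
        (feasible⇒prefixSumsNonneg _ a b f k)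

prefixSumsNonneg⇒feasible : ∀ {m} s (a b : Vec ℕ m) → s ℤ.+ (+ sum a ℤ.- + sum b) ≡ +0 →
                            PrefixSumsNonneg s a b → Feasible s ((a ⊖ b) ∷ʳ +0)
prefixSumsNonneg⇒feasible s []      []      total _      = total
prefixSumsNonneg⇒feasible s (x ∷ a) (y ∷ b) total nonneg =
  nonneg Fin.zero ,
  prefixSumsNonneg⇒feasible _ a b (trans (eq _ _) total)
    (λ k → subst (+0 ℤ.≤_) (sym (eq _ _)) (nonneg (Fin.suc k)))
  where eq = [s+[x-y]]+[p-q]≡s+[[x+p]-[y+q]] s x y

feasible⇔prefixSumsNonneg : ∀ {m} s (a b : Vec ℕ m) → s ℤ.+ (+ sum a ℤ.- + sum b) ≡ +0 →
                            Feasible s ((a ⊖ b) ∷ʳ +0) ⇔ PrefixSumsNonneg s a b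
feasible⇔prefixSumsNonneg s a b total =
  mk⇔ (feasible⇒prefixSumsNonneg s a b) (prefixSumsNonneg⇒feasible s a b total)

sum-δ : ∀ n → sum (δ n) ≡ n C 2
sum-δ zero    = refl
sum-δ (suc n) = trans (cong₂ _+_ (sym (nC1≡n n)) (sum-δ n)) (nCk+nC[k+1]≡[n+1]C[k+1] n 1)

0≤0+[p-q]⇔q≤p : ∀ p q → +0 ℤ.≤ +0 ℤ.+ (+ p ℤ.- + q) ⇔ q ≤ p
0≤0+[p-q]⇔q≤p p q = mk⇔
  (λ 0≤p-q → ℤ.drop‿+≤+ (ℤ.0≤i-j⇒j≤i (subst (+0 ℤ.≤_) (ℤ.+-identityˡ _) 0≤p-q)))
  (λ q≤p → subst (+0 ℤ.≤_) (sym (ℤ.+-identityˡ _)) (ℤ.i≤j⇒0≤j-i (+≤+ q≤p)))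

m+[n∸[1+i]]≡m+n∸i∸1 : ∀ m {n i} → i < n → m + (n ∸ suc i) ≡ m + n ∸ i ∸ 1
m+[n∸[1+i]]≡m+n∸i∸1 m {n} {i} i<n = begin
  m + (n ∸ suc i)  ≡⟨ +-∸-assoc m i<n ⟨
  m + n ∸ suc i    ≡⟨ cong (m + n ∸_) (+-comm 1 i) ⟩
  m + n ∸ (i + 1)  ≡⟨ ∸-+-assoc (m + n) i 1 ⟨
  m + n ∸ i ∸ 1    ∎
  where open ≡-Reasoning

binomials-positive⇔bounds : ∀ n (N j : Vec ℕ n) →
  0 < foldr _ _*_ 1 (tabulate (λ i → (lookup N i + (n ∸ suc (toℕ i))) C lookup j i))
  ⇔ ((i : Fin n) → lookup j i ≤ lookup N i + n ∸ toℕ i ∸ 1)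
binomials-positive⇔bounds n N j = Π-cong-⇔ bound ⇔-∘ 0<product⇔all-0< n _
  where
  bound : (i : Fin n) → 0 < (lookup N i + (n ∸ suc (toℕ i))) C lookup j i
                        ⇔ lookup j i ≤ lookup N i + n ∸ toℕ i ∸ 1
  bound i rewrite m+[n∸[1+i]]≡m+n∸i∸1 (lookup N i) (toℕ<n i) = 0<nCk⇔k≤n _ _

kostant-positive⇔dominance : ∀ n (j : Vec ℕ n) → IsWeakComp n j →
  0 < K n (j-δ n j) ⇔ ((k : Fin n) → psum (δ n) (toℕ k) ≤ psum j (toℕ k))
kostant-positive⇔dominance n j sum-j≡nC2 rewrite j-δ≡⊖∷ʳ0 n j =
  Π-cong-⇔ (λ k → 0≤0+[p-q]⇔q≤p _ _)
  ⇔-∘ (feasible⇔prefixSumsNonneg +0 j (δ n) total ⇔-∘ 0<K⇔feasible n _)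
  where
  total : +0 ℤ.+ (+ sum j ℤ.- + sum (δ n)) ≡ +0
  total = trans (ℤ.+-identityˡ _) (ℤ.i≡j⇒i-j≡0 (cong +_ (trans sum-j≡nC2 (sym (sum-δ n)))))

proposition6p4 : (n : ℕ) (N j : Vec ℕ n) → IsWeakComp n j →
    (InSplus n N j ⇔
      (((i : Fin n) → lookup j i ≤ lookup N i + n ∸ toℕ i ∸ 1)
       × ((k : Fin n) → psum (δ n) (toℕ k) ≤ psum j (toℕ k))))
proposition6p4 n N j isWeakComp =
  (binomials-positive⇔bounds n N j ×-⇔ kostant-positive⇔dominance n j isWeakComp)
  ⇔-∘ (0<m*n⇔0<m×0<n _ _ ⇔-∘ mk⇔ proj₂ (isWeakComp ,_))
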